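{- Let $g_5:\{\texttt{0},\texttt{1},\texttt{2}\}^*\to\{\texttt{0},\texttt{1}\}^*$ be the morphism $g_5(\texttt{0})=\texttt{0000100000111000011000111}$, $g_5(\texttt{1})=\texttt{000010000011000111}$, $g_5(\texttt{2})=\texttt{0000011}$. Every bi-infinite binary word whose only square factors are $\texttt{00}$, $\texttt{11}$, $\texttt{0000}$, $\texttt{0001100011}$ and $\texttt{1000010000}$ has the same set of finite factors as $g_5(b_3)$.
   Context: $b_3$ is the Hall–Thue word, the fixed point starting with $\texttt{0}$ of the morphism $\texttt{0}\mapsto\texttt{012}$, $\texttt{1}\mapsto\texttt{02}$, $\texttt{2}\mapsto\texttt{1}$. A square is a nonempty word of the form $uu$. -}

module Defs where

open import Data.Nat using (ℕ; zero; suc; _>_)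
open import Data.Integer using (ℤ; +_; _+_)
open import Data.List using (List; []; _∷_; _++_; concatMap; map; length)
open import Data.Product using (Σ; ∃; _×_; _,_)
open import Data.List.Membership.Propositional using (_∈_)
open import Relation.Binary.PropositionalEquality using (_≡_)

data Bin : Set where
  b0 b1 : Bin

data Ter : Set where
  t0 t1 t2 : Ter

bits : List ℕ → List Bin
bits = map (λ { zero → b0 ; (suc _) → b1 })

applyMorph : {A B : Set} → (A → List B) → List A → List B
applyMorph h w = concatMap h w

φ : Ter → List Ter
φ t0 = t0 ∷ t1 ∷ t2 ∷ []
φ t1 = t0 ∷ t2 ∷ []
φ t2 = t1 ∷ []

-- φ^k(0): these are prefixes of the fixed point b₃ = lim φ^k(0)
φIter : ℕ → List Ter
φIter zero = t0 ∷ []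
φIter (suc k) = applyMorph φ (φIter k)

g5 : Ter → List Bin
g5 t0 = bits (0 ∷ 0 ∷ 0 ∷ 0 ∷ 1 ∷ 0 ∷ 0 ∷ 0 ∷ 0 ∷ 0 ∷ 1 ∷ 1 ∷ 1 ∷ 0 ∷ 0 ∷ 0 ∷ 0 ∷ 1 ∷ 1 ∷ 0 ∷ 0 ∷ 0 ∷ 1 ∷ 1 ∷ 1 ∷ [])
g5 t1 = bits (0 ∷ 0 ∷ 0 ∷ 0 ∷ 1 ∷ 0 ∷ 0 ∷ 0 ∷ 0 ∷ 0 ∷ 1 ∷ 1 ∷ 0 ∷ 0 ∷ 0 ∷ 1 ∷ 1 ∷ 1 ∷ [])
g5 t2 = bits (0 ∷ 0 ∷ 0 ∷ 0 ∷ 0 ∷ 1 ∷ 1 ∷ [])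

IsFactor : {A : Set} → List A → List A → Set
IsFactor {A} u v = Σ (List A) λ p → Σ (List A) λ s → p ++ u ++ s ≡ v

-- u is a finite factor of the infinite word g₅(b₃):
-- since g₅(φ^k(0)) is a prefix of g₅(b₃) for each k and these prefixes
-- exhaust g₅(b₃), this is the same as occurring in g₅(b₃).
FactorOfG5b3 : List Bin → Set
FactorOfG5b3 u = ∃ λ k → IsFactor u (applyMorph g5 (φIter k))

BiWord : Set
BiWord = ℤ → Bin

slice : BiWord → ℤ → ℕ → List Bin
slice w i zero = []
slice w i (suc n) = w i ∷ slice w (i + + 1) n

FactorOfBi : BiWord → List Bin → Set
FactorOfBi w u = ∃ λ (i : ℤ) → slice w i (length u) ≡ u

allowedSquares : List (List Bin)
allowedSquares =
  bits (0 ∷ 0 ∷ []) ∷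
  bits (1 ∷ 1 ∷ []) ∷
  bits (0 ∷ 0 ∷ 0 ∷ 0 ∷ []) ∷
  bits (0 ∷ 0 ∷ 0 ∷ 1 ∷ 1 ∷ 0 ∷ 0 ∷ 0 ∷ 1 ∷ 1 ∷ []) ∷
  bits (1 ∷ 0 ∷ 0 ∷ 0 ∷ 0 ∷ 1 ∷ 0 ∷ 0 ∷ 0 ∷ 0 ∷ []) ∷
  []

OnlyAllowedSquares : BiWord → Set
OnlyAllowedSquares w =
  (u : List Bin) → length u > 0 → FactorOfBi w (u ++ u) → (u ++ u) ∈ allowedSquares

-- A binary word all of whose squares are allowed can, away from its ends, be cut uniquely into the
-- blocks g5(0), g5(1), g5(2): any 54 consecutive letters contain one of three 18-letter contexts that
-- mark a cut, and after a cut the next block is forced (both are finite explorations). The cut word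
-- is admissible: squarefree, without 010 and without 212 in its interior, since each of these would
-- create a long square under g5. Admissible words are desubstituted by φ, and a factor lying deep
-- inside one shrinks under desubstitution by φ² until a finite check places it in φ⁶(0). So every
-- factor of w is a factor of g5(b₃). Conversely a long window of w desubstitutes to a long admissible
-- word, and iterating the desubstitution by φ shows that it contains φᵏ(0).

module Submission where

open import Defs
open import Data.Bool using (Bool; true; false; T; not; _∧_; _∨_)
open import Data.Bool.Properties using (T-∧; T-∨; T-≡)
open import Data.Empty using (⊥; ⊥-elim)
open import Data.Bool.ListAction using (all; any)
open import Data.List using (List; []; _∷_; _++_; length; take; drop; reverse; _ʳ++_)
open import Data.List.Properties
  using (++-assoc; ++-identityʳ; length-++; ++-cancelˡ; ++-conicalˡ; ∷-injective;
         concatMap-++; take++drop≡id; length-take; length-drop; reverse-++; reverse-involutive; length-reverse; ʳ++-defn)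
open import Data.List.Membership.Propositional using (_∈_)
open import Data.List.Relation.Unary.All as All using (All)
open import Data.List.Relation.Unary.All.Properties using (all⁺)
open import Data.List.Relation.Unary.Any as Any using (here; there; satisfied)
open import Data.List.Relation.Unary.Any.Properties using (any⁺; any⁻)
open import Data.Nat using (ℕ; zero; suc; _+_; _*_; _∸_; _≤_; _<_; z≤n; s≤s; _≤?_)
open import Data.Nat.Properties
open import Data.Product using (∃; ∃₂; _×_; _,_; proj₁; proj₂)
open import Data.Sum using (_⊎_; inj₁; inj₂)
open import Data.Integer using (-_; _-_) renaming (_+_ to _+ℤ_; +_ to toℤ)
open import Data.Integer.Properties using ()
  renaming (+-assoc to +ℤ-assoc; +-identityʳ to +ℤ-identityʳ; +-inverseˡ to +ℤ-inverseˡ)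
open import Function.Bundles using (Equivalence; _⇔_; mk⇔)
open import Relation.Binary.Definitions using (DecidableEquality)
open import Relation.Binary.PropositionalEquality
open import Relation.Nullary using (¬_; yes; no)
open import Relation.Nullary.Decidable using (isYes; from-yes)

private variable
  A B C : Set

++-regroup : (p x y z s : List A) → p ++ (x ++ y ++ z) ++ s ≡ (p ++ x) ++ y ++ z ++ s
++-regroup p x y z s = begin
  p ++ (x ++ y ++ z) ++ s  ≡⟨ cong (p ++_) (++-assoc x (y ++ z) s) ⟩
  p ++ x ++ (y ++ z) ++ s  ≡⟨ cong (λ w → p ++ x ++ w) (++-assoc y z s) ⟩
  p ++ x ++ y ++ z ++ s    ≡⟨ ++-assoc p x _ ⟨
  (p ++ x) ++ y ++ z ++ s  ∎
  where open ≡-Reasoning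

IsFactor-trans : {x y z : List A} → IsFactor x y → IsFactor y z → IsFactor x z
IsFactor-trans {x = x} (p , s , refl) (p′ , s′ , refl) = p′ ++ p , s ++ s′ , sym (++-regroup p′ p x s s′)

applyMorph-∘ : (f : A → List B) (g : B → List C) (z : List A) →
               applyMorph g (applyMorph f z) ≡ applyMorph (λ a → applyMorph g (f a)) z
applyMorph-∘ f g [] = refl
applyMorph-∘ f g (a ∷ z) =
  trans (concatMap-++ g (f a) (applyMorph f z)) (cong (applyMorph g (f a) ++_) (applyMorph-∘ f g z))

IsFactor-applyMorph : (h : A → List B) {x y : List A} → IsFactor x y → IsFactor (applyMorph h x) (applyMorph h y)
IsFactor-applyMorph h {x} (p , s , refl) = applyMorph h p , applyMorph h s ,
  sym (trans (concatMap-++ h p (x ++ s)) (cong (applyMorph h p ++_) (concatMap-++ h x s)))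

IsFactor-square-applyMorph : (h : A → List B) {u y : List A} → IsFactor (u ++ u) y →
                             IsFactor (applyMorph h u ++ applyMorph h u) (applyMorph h y)
IsFactor-square-applyMorph h {u} f = subst (λ w → IsFactor w _) (concatMap-++ h u u) (IsFactor-applyMorph h f)

length-applyMorph-≤ : {h : A → List B} {κ : ℕ} → (∀ a → length (h a) ≤ κ) →
                      ∀ z → length (applyMorph h z) ≤ κ * length z
length-applyMorph-≤ {κ = κ} h≤ [] = ≤-reflexive (sym (*-zeroʳ κ))
length-applyMorph-≤ {h = h} {κ} h≤ (a ∷ z) = begin
  length (h a ++ applyMorph h z)    ≡⟨ length-++ (h a) ⟩
  length (h a) + length (applyMorph h z) ≤⟨ +-mono-≤ (h≤ a) (length-applyMorph-≤ h≤ z) ⟩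
  κ + κ * length z                  ≡⟨ *-suc κ (length z) ⟨
  κ * suc (length z)                ∎
  where open ≤-Reasoning

length-applyMorph-≥ : {h : A → List B} {κ : ℕ} → (∀ a → κ ≤ length (h a)) →
                      ∀ z → κ * length z ≤ length (applyMorph h z)
length-applyMorph-≥ {κ = κ} h≥ [] = ≤-reflexive (*-zeroʳ κ)
length-applyMorph-≥ {h = h} {κ} h≥ (a ∷ z) = begin
  κ * suc (length z)                ≡⟨ *-suc κ (length z) ⟩
  κ + κ * length z                  ≤⟨ +-mono-≤ (h≥ a) (length-applyMorph-≥ h≥ z) ⟩
  length (h a) + length (applyMorph h z) ≡⟨ length-++ (h a) ⟨
  length (h a ++ applyMorph h z)    ∎
  where open ≤-Reasoning

length-++³ : (x y z : List A) → length (x ++ y ++ z) ≡ length x + (length y + length z)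
length-++³ x y z = trans (length-++ x) (cong (length x +_) (length-++ y))

++-split : (a b c d : List A) → a ++ b ≡ c ++ d → length c ≤ length a →
           ∃ λ x → a ≡ c ++ x × d ≡ x ++ b
++-split a b [] d e _ = a , refl , sym e
++-split (x ∷ a) b (y ∷ c) d e (s≤s c≤a) with ∷-injective e
... | refl , e′ with ++-split a b c d e′ c≤a
...   | m , refl , refl = m , refl , refl

++-split-length : (a b c d : List A) → a ++ b ≡ c ++ d → length a ≡ length c → a ≡ c × b ≡ d
++-split-length a b c d e |a|≡|c| with ++-split a b c d e (≤-reflexive (sym |a|≡|c|))
... | [] , refl , refl = ++-identityʳ c , refl
... | x ∷ m , refl , _ = ⊥-elim (m+1+n≢m (length c) (trans (sym (length-++ c)) |a|≡|c|))

++-split-right : (a b c d : List A) → a ++ b ≡ c ++ d → length d ≤ length b →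
                 ∃ λ x → b ≡ x ++ d × c ≡ a ++ x
++-split-right a b c d e d≤b with ++-split c d a b (sym e) a≤c
  where
  a≤c : length a ≤ length c
  a≤c = +-cancelʳ-≤ (length b) (length a) (length c) (begin
    length a + length b  ≡⟨ length-++ a ⟨
    length (a ++ b)      ≡⟨ cong length e ⟩
    length (c ++ d)      ≡⟨ length-++ c ⟩
    length c + length d  ≤⟨ +-monoʳ-≤ (length c) d≤b ⟩
    length c + length b  ∎)
    where open ≤-Reasoning
... | x , c≡ , b≡ = x , b≡ , c≡

length-sandwich : ∀ {i j} (x y z : List A) → length x ≤ i → length z ≤ j →
                  length (x ++ y ++ z) ≤ length y + (j + i)
length-sandwich {i = i} {j} x y z x≤i z≤j = begin
  length (x ++ y ++ z)              ≡⟨ length-++³ x y z ⟩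
  length x + (length y + length z)  ≤⟨ +-mono-≤ x≤i (+-monoʳ-≤ (length y) z≤j) ⟩
  i + (length y + j)                ≡⟨ trans (+-comm i _) (+-assoc (length y) j i) ⟩
  length y + (j + i)                ∎
  where open ≤-Reasoning

take-length-++ : (x y : List A) → take (length x) (x ++ y) ≡ x
take-length-++ [] y = refl
take-length-++ (a ∷ x) y = cong (a ∷_) (take-length-++ x y)

drop-length-++ : (x y : List A) → drop (length x) (x ++ y) ≡ y
drop-length-++ [] y = refl
drop-length-++ (a ∷ x) y = drop-length-++ x y

length-applyMorph-head : (h : A → List B) (a : A) (z : List A) → length (h a) ≤ length (applyMorph h (a ∷ z))
length-applyMorph-head h a z = ≤-trans (m≤m+n _ _) (≤-reflexive (sym (length-++ (h a))))

Inner : ℕ → List A → List A → Set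
Inner m t v = ∃₂ λ p s → v ≡ p ++ t ++ s × m ≤ length p × m ≤ length s

Overhang : ℕ → List A → List A → Set
Overhang ℓ t w = ∃₂ λ a b → w ≡ a ++ t ++ b × length a ≤ ℓ × length b ≤ ℓ

Inner-weaken : ∀ {m m′} {t v : List A} → m′ ≤ m → Inner m t v → Inner m′ t v
Inner-weaken m′≤m (p , s , e , m≤p , m≤s) = p , s , e , ≤-trans m′≤m m≤p , ≤-trans m′≤m m≤s

Inner-exact : ∀ {m} {t v : List A} → Inner m t v →
              ∃₂ λ b s → IsFactor (b ++ t ++ s) v × length b ≡ m × length s ≡ m
Inner-exact {m = m} {t} (p , s , refl , m≤p , m≤s) =
  drop k p , take m s ,
  (take k p , drop m s ,
   trans (++-regroup (take k p) (drop k p) t (take m s) (drop m s))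
         (cong₂ (λ p′ s′ → p′ ++ t ++ s′) (take++drop≡id k p) (take++drop≡id m s))) ,
  trans (length-drop k p) (m∸[m∸n]≡n m≤p) ,
  trans (length-take m s) (m≤n⇒m⊓n≡m m≤s)
  where k = length p ∸ m

Overhang⇒IsFactor : ∀ {ℓ} {t w : List A} → Overhang ℓ t w → IsFactor t w
Overhang⇒IsFactor (a , b , e , _) = a , b , sym e

Overhang-length : ∀ {ℓ} {t w : List A} → Overhang ℓ t w → length w ≤ length t + (ℓ + ℓ)
Overhang-length {ℓ = ℓ} {t} (a , b , refl , a≤ℓ , b≤ℓ) = begin
  length (a ++ t ++ b)              ≡⟨ length-++³ a t b ⟩
  length a + (length t + length b)  ≤⟨ +-mono-≤ a≤ℓ (+-monoʳ-≤ (length t) b≤ℓ) ⟩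
  ℓ + (length t + ℓ)                ≡⟨ trans (+-comm ℓ _) (+-assoc (length t) ℓ ℓ) ⟩
  length t + (ℓ + ℓ)                ∎
  where open ≤-Reasoning

applyMorph-++³ : (h : A → List B) (x y z : List A) →
                 applyMorph h (x ++ y ++ z) ≡ applyMorph h x ++ applyMorph h y ++ applyMorph h z
applyMorph-++³ h x y z = trans (concatMap-++ h x (y ++ z)) (cong (applyMorph h x ++_) (concatMap-++ h y z))

Overhang-∘ : {h : A → List B} {κ c d : ℕ} {y : List B} {x z : List A} → (∀ a → length (h a) ≤ κ) →
             Overhang c (applyMorph h z) y → Overhang d x z → Overhang (c + κ * d) (applyMorph h x) y
Overhang-∘ {h = h} {κ} {c} {d} {x = x} h≤ (a , b , refl , a≤ , b≤) (a′ , b′ , refl , a′≤ , b′≤) =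
  a ++ h* a′ , h* b′ ++ b ,
  trans (cong (λ v → a ++ v ++ b) (applyMorph-++³ h a′ x b′)) (++-regroup a (h* a′) (h* x) (h* b′) b) ,
  ≤-trans (≤-reflexive (length-++ a {h* a′})) (+-mono-≤ a≤ (scaled a′ a′≤)) ,
  ≤-trans (≤-reflexive (trans (length-++ (h* b′) {b}) (+-comm (length (h* b′)) (length b))))
          (+-mono-≤ b≤ (scaled b′ b′≤))
  where
  h* = applyMorph h
  scaled : ∀ v → length v ≤ d → length (h* v) ≤ κ * d
  scaled v v≤d = ≤-trans (length-applyMorph-≤ h≤ v) (*-monoʳ-≤ κ v≤d)

EverySquare : (List A → Set) → List A → Set
EverySquare Q v = ∀ u → 0 < length u → IsFactor (u ++ u) v → Q u

EverySquare-factor : {Q : List A → Set} {x v : List A} → EverySquare Q v → IsFactor x v → EverySquare Q x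
EverySquare-factor sq x⊑v u u>0 uu⊑x = sq u u>0 (IsFactor-trans uu⊑x x⊑v)

T-not-∨⇒ : ∀ {a b} → T (not a ∨ b) → T a → T b
T-not-∨⇒ {true} b _ = b

reverse-ʳ++ : (xs ys : List A) → reverse (xs ʳ++ ys) ≡ reverse ys ++ xs
reverse-ʳ++ xs ys = begin
  reverse (xs ʳ++ ys)                ≡⟨ cong reverse (ʳ++-defn xs) ⟩
  reverse (reverse xs ++ ys)         ≡⟨ reverse-++ (reverse xs) ys ⟩
  reverse ys ++ reverse (reverse xs) ≡⟨ cong (reverse ys ++_) (reverse-involutive xs) ⟩
  reverse ys ++ xs                   ∎
  where open ≡-Reasoning

IsFactor-reverse-square : (x c : List A) → IsFactor (reverse x ++ reverse x) (reverse (x ++ x ++ c))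
IsFactor-reverse-square x c = reverse c , [] , (begin
  reverse c ++ (reverse x ++ reverse x) ++ []  ≡⟨ cong (reverse c ++_) (++-identityʳ _) ⟩
  reverse c ++ reverse x ++ reverse x          ≡⟨ ++-assoc (reverse c) (reverse x) (reverse x) ⟨
  (reverse c ++ reverse x) ++ reverse x        ≡⟨ cong (_++ reverse x) (reverse-++ x c) ⟨
  reverse (x ++ c) ++ reverse x                ≡⟨ reverse-++ x (x ++ c) ⟨
  reverse (x ++ x ++ c)                        ∎)
  where open ≡-Reasoning

ʳ++-of-reverse : (xs ys : List A) → reverse xs ʳ++ ys ≡ xs ++ ys
ʳ++-of-reverse xs ys = trans (ʳ++-defn (reverse xs)) (cong (_++ ys) (reverse-involutive xs))

length-take-≤ : ∀ n (v : List A) → length (take n v) ≤ n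
length-take-≤ n v = ≤-trans (≤-reflexive (length-take n v)) (m⊓n≤m n (length v))

-- Words under exploration are stored reversed, so that extending them by a letter is consing.

module ReversedTests {A : Set} (_≟_ : DecidableEquality A) where

  -- A Boolean test rather than ≡-dec, which is much slower to evaluate during type checking.
  _==_ : List A → List A → Bool
  [] == [] = true
  (x ∷ xs) == (y ∷ ys) = isYes (x ≟ y) ∧ (xs == ys)
  _ == _ = false

  ==-sound : ∀ xs ys → T (xs == ys) → xs ≡ ys
  ==-sound [] [] _ = refl
  ==-sound (x ∷ xs) (y ∷ ys) eq with x ≟ y
  ... | yes refl = cong (x ∷_) (==-sound xs ys eq)

  ==-refl : ∀ xs → T (xs == xs)
  ==-refl [] = _
  ==-refl (x ∷ xs) with x ≟ x
  ... | yes _ = ==-refl xs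
  ... | no x≢x = ⊥-elim (x≢x refl)

  endsWith? : List A → List A → Bool
  endsWith? f rw = take (length f) rw == reverse f

  endsWith?-sound : ∀ f rw → T (endsWith? f rw) → ∃ λ r → reverse rw ≡ r ++ f
  endsWith?-sound f rw found = reverse (drop (length f) rw) , (begin
    reverse rw                                           ≡⟨ cong reverse (take++drop≡id (length f) rw) ⟨
    reverse (take (length f) rw ++ drop (length f) rw)   ≡⟨ reverse-++ (take (length f) rw) (drop (length f) rw) ⟩
    r ++ reverse (take (length f) rw)                    ≡⟨ cong (λ x → r ++ reverse x) e ⟩
    r ++ reverse (reverse f)                             ≡⟨ cong (r ++_) (reverse-involutive f) ⟩
    r ++ f                                               ∎)
    where
    open ≡-Reasoning
    r = reverse (drop (length f) rw)
    e = ==-sound (take (length f) rw) (reverse f) found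

  avoids⇒¬endsWith? : ∀ f rw → ¬ IsFactor f (reverse rw) → T (not (endsWith? f rw))
  avoids⇒¬endsWith? f rw ¬f⊑ with endsWith? f rw | endsWith?-sound f rw
  ... | false | _ = _
  ... | true | sound with sound _
  ...   | r , e = ⊥-elim (¬f⊑ (r , [] , trans (cong (r ++_) (++-identityʳ f)) (sym e)))

  isFactor? : List A → List A → Bool
  isFactor? u [] = u == []
  isFactor? u (x ∷ w) = (take (length u) (x ∷ w) == u) ∨ isFactor? u w

  isFactor?-sound : ∀ u w → T (isFactor? u w) → IsFactor u w
  isFactor?-sound u [] found with ==-sound u [] found
  ... | refl = [] , [] , refl
  isFactor?-sound u (x ∷ w) found with take (length u) (x ∷ w) == u | ==-sound (take (length u) (x ∷ w)) u
  ... | true | sound = [] , drop (length u) (x ∷ w) ,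
    trans (cong (_++ drop (length u) (x ∷ w)) (sym (sound _))) (take++drop≡id (length u) (x ∷ w))
  ... | false | _ with isFactor?-sound u w found
  ...   | p , s , e = x ∷ p , s , cong (x ∷_) e

  squareSuffixesOK? : (List A → Bool) → ℕ → List A → Bool
  squareSuffixesOK? allowed? zero rw = true
  squareSuffixesOK? allowed? (suc l) rw =
    squareSuffixesOK? allowed? l rw ∧
    (not (take (suc l) rw == take (suc l) (drop (suc l) rw)) ∨ allowed? (reverse (take (suc l) rw)))

  squareSuffixesOK?-sound : ∀ {Q : List A → Set} allowed? → (∀ u → Q u → T (allowed? u)) →
                            ∀ l c rw → EverySquare Q (reverse (c ∷ rw)) → T (squareSuffixesOK? allowed? l (c ∷ rw))
  squareSuffixesOK?-sound allowed? sound zero c rw sq = _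
  squareSuffixesOK?-sound allowed? sound (suc l) c rw sq =
    Equivalence.from T-∧ (squareSuffixesOK?-sound allowed? sound l c rw sq , half-allowed)
    where
    half = take (suc l) (c ∷ rw)
    rest = drop (suc l) (c ∷ rw)
    half-allowed : T (not (half == take (suc l) rest) ∨ allowed? (reverse half))
    half-allowed with half == take (suc l) rest | ==-sound half (take (suc l) rest)
    ... | false | _ = _
    ... | true | equal = sound (reverse half) (sq (reverse half) (subst (0 <_) (sym (length-reverse half)) (s≤s z≤n))
                           (subst (λ w → IsFactor (reverse half ++ reverse half) (reverse w)) (sym c∷rw≡)
                                  (IsFactor-reverse-square half (drop (suc l) rest))))
      where
      c∷rw≡ : c ∷ rw ≡ half ++ half ++ drop (suc l) rest
      c∷rw≡ = begin
        c ∷ rw                                       ≡⟨ take++drop≡id (suc l) (c ∷ rw) ⟨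
        half ++ rest                                 ≡⟨ cong (half ++_) (take++drop≡id (suc l) rest) ⟨
        half ++ take (suc l) rest ++ drop (suc l) rest ≡⟨ cong (λ x → half ++ x ++ drop (suc l) rest) (equal _) ⟨
        half ++ half ++ drop (suc l) rest            ∎
        where open ≡-Reasoning

explore : List A → (ok? stop? leaf? : List A → Bool) → ℕ → List A → Bool
explore letters ok? stop? leaf? zero rw = leaf? rw
explore letters ok? stop? leaf? (suc n) rw =
  stop? rw ∨ all (λ c → not (ok? (c ∷ rw)) ∨ explore letters ok? stop? leaf? n (c ∷ rw)) letters

module Exploration {A : Set} (letters : List A) (letters-complete : ∀ a → a ∈ letters)
  (P : List A → Set) (P-prefix : ∀ x y → P (x ++ y) → P x)
  (ok? : List A → Bool) (ok?-sound : ∀ c rw → P (reverse (c ∷ rw)) → T (ok? (c ∷ rw))) where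

  explore-sound : ∀ {stop? leaf?} n rw x → length x ≡ n → T (explore letters ok? stop? leaf? n rw) →
                  P (rw ʳ++ x) →
                  (∃₂ λ x₁ x₂ → x ≡ x₁ ++ x₂ × T (stop? (x₁ ʳ++ rw))) ⊎ T (leaf? (x ʳ++ rw))
  explore-sound zero rw [] refl found _ = inj₂ found
  explore-sound {stop?} {leaf?} (suc n) rw (c ∷ x) refl found Px with Equivalence.to T-∨ found
  ... | inj₁ stopped = inj₁ ([] , c ∷ x , refl , stopped)
  ... | inj₂ children with explore-sound n (c ∷ rw) x refl (T-not-∨⇒ child (ok?-sound c rw P[c∷rw])) Px
    where
    child : T (not (ok? (c ∷ rw)) ∨ explore letters ok? stop? leaf? n (c ∷ rw))
    child = All.lookup (all⁺ _ letters children) (letters-complete c)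
    P[c∷rw] : P (reverse (c ∷ rw))
    P[c∷rw] = P-prefix (reverse (c ∷ rw)) x (subst P (ʳ++-defn (c ∷ rw)) Px)
  ...   | inj₁ (x₁ , x₂ , refl , stopped) = inj₁ (c ∷ x₁ , x₂ , refl , stopped)
  ...   | inj₂ leaf = inj₂ leaf

  explore-prefix : ∀ {found?} n rw v → n ≤ length v → explore letters ok? found? found? n rw ≡ true →
                   P (rw ʳ++ v) →
                   ∃₂ λ x₁ x₂ → v ≡ x₁ ++ x₂ × length x₁ ≤ n × T (found? (x₁ ʳ++ rw))
  explore-prefix n rw v n≤|v| found Pv
    with explore-sound n rw (take n v) (trans (length-take n v) (m≤n⇒m⊓n≡m n≤|v|))
                       (Equivalence.from T-≡ found) P[take]
    where
    P[take] : P (rw ʳ++ take n v)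
    P[take] = P-prefix _ (drop n v) (subst P (begin
      rw ʳ++ v                            ≡⟨ cong (rw ʳ++_) (take++drop≡id n v) ⟨
      rw ʳ++ (take n v ++ drop n v)       ≡⟨ ʳ++-defn rw ⟩
      reverse rw ++ take n v ++ drop n v  ≡⟨ ++-assoc (reverse rw) (take n v) (drop n v) ⟨
      (reverse rw ++ take n v) ++ drop n v ≡⟨ cong (_++ drop n v) (ʳ++-defn rw) ⟨
      (rw ʳ++ take n v) ++ drop n v       ∎) Pv)
      where open ≡-Reasoning
  ... | inj₁ (x₁ , x₂ , e , stopped) =
    x₁ , x₂ ++ drop n v ,
    trans (sym (take++drop≡id n v)) (trans (cong (_++ drop n v) e) (++-assoc x₁ x₂ (drop n v))) ,
    ≤-trans (≤-trans (m≤m+n (length x₁) (length x₂)) (≤-reflexive (trans (sym (length-++ x₁)) (cong length (sym e)))))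
            (length-take-≤ n v) ,
    stopped
  ... | inj₂ leaf = take n v , drop n v , sym (take++drop≡id n v) , length-take-≤ n v , leaf

module Desubstitution {A B : Set} (h : A → List B) (ℓ : ℕ) (h-short : ∀ a → length (h a) ≤ suc ℓ) where

  private
    h* : List A → List B
    h* = applyMorph h

  locateˡ : ∀ z P X → h* z ≡ P ++ X →
            ∃₂ λ P′ z₂ → ∃ λ a → z ≡ P′ ++ z₂ × P ≡ h* P′ ++ a × h* z₂ ≡ a ++ X × length a ≤ ℓ
  locateˡ [] P X e with ++-conicalˡ P X (sym e)
  ... | refl = [] , [] , [] , refl , refl , e , z≤n
  locateˡ (c ∷ z) P X e with length (h c) ≤? length P
  ... | yes hc≤P with ++-split P X (h c) (h* z) (sym e) hc≤P
  ...   | P₁ , refl , e′ with locateˡ z P₁ X e′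
  ...     | P′ , z₂ , a , refl , refl , e″ , a≤ℓ =
    c ∷ P′ , z₂ , a , refl , sym (++-assoc (h c) (h* P′) a) , e″ , a≤ℓ
  locateˡ (c ∷ z) P X e | no hc≰P =
    [] , c ∷ z , P , refl , refl , e , ≤-pred (≤-trans (≰⇒> hc≰P) (h-short c))

  locateʳ : ∀ z Y S → h* z ≡ Y ++ S →
            ∃₂ λ z₁ S′ → ∃ λ b → z ≡ z₁ ++ S′ × S ≡ b ++ h* S′ × h* z₁ ≡ Y ++ b × length b ≤ ℓ
  locateʳ z [] S e = [] , z , [] , refl , sym e , refl , z≤n
  locateʳ (c ∷ z) (y ∷ Y) S e with length (h c) ≤? length (y ∷ Y)
  ... | yes hc≤Y with ++-split (y ∷ Y) S (h c) (h* z) (sym e) hc≤Y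
  ...   | Y₁ , e₁ , e₂ with locateʳ z Y₁ S e₂
  ...     | z₁ , S′ , b , refl , S≡ , e₃ , b≤ℓ = c ∷ z₁ , S′ , b , refl , S≡ , (begin
    h c ++ h* z₁     ≡⟨ cong (h c ++_) e₃ ⟩
    h c ++ Y₁ ++ b   ≡⟨ ++-assoc (h c) Y₁ b ⟨
    (h c ++ Y₁) ++ b ≡⟨ cong (_++ b) e₁ ⟨
    (y ∷ Y) ++ b     ∎) , b≤ℓ
    where open ≡-Reasoning
  locateʳ (c ∷ z) (y ∷ Y) S e | no hc≰Y with ++-split (h c) (h* z) (y ∷ Y) S e (<⇒≤ (≰⇒> hc≰Y))
  ...   | b , e₁ , e₂ = c ∷ [] , z , b , refl , e₂ , trans (++-identityʳ (h c)) e₁ ,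
    ≤-trans (m≤n+m (length b) (length Y))
            (≤-pred (subst (_≤ suc ℓ) (trans (cong length e₁) (cong suc (length-++ Y))) (h-short c)))

  record Located (z : List A) (P t S : List B) : Set where
    constructor located
    field
      P′ t′ S′ : List A
      a b : List B
      z≡ : z ≡ P′ ++ t′ ++ S′
      P≡ : P ≡ h* P′ ++ a
      S≡ : S ≡ b ++ h* S′
      t′≡ : h* t′ ≡ a ++ t ++ b
      a≤ℓ : length a ≤ ℓ
      b≤ℓ : length b ≤ ℓ

  locate : ∀ z P t S → h* z ≡ P ++ t ++ S → Located z P t S
  locate z P t S e with locateˡ z P (t ++ S) e
  ... | P′ , z₂ , a , refl , P≡ , e₂ , a≤ℓ with locateʳ z₂ (a ++ t) S (trans e₂ (sym (++-assoc a t S)))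
  ...   | t′ , S′ , b , refl , S≡ , e₃ , b≤ℓ =
    located P′ t′ S′ a b refl P≡ S≡ (trans e₃ (++-assoc a t b)) a≤ℓ b≤ℓ

  preimage-long : ∀ m c z → suc ℓ * m + c ≤ length (h* z) + (ℓ + c) → m ≤ length z
  preimage-long m c z long = ≤-pred (*-cancelˡ-< (suc ℓ) m (suc (length z)) (begin-strict
    suc ℓ * m                   ≤⟨ +-cancelʳ-≤ c _ _ (≤-trans long (≤-reflexive (sym (+-assoc (length (h* z)) ℓ c)))) ⟩
    length (h* z) + ℓ           ≤⟨ +-monoˡ-≤ ℓ (length-applyMorph-≤ h-short z) ⟩
    suc ℓ * length z + ℓ        <⟨ +-monoʳ-< (suc ℓ * length z) (n<1+n ℓ) ⟩
    suc ℓ * length z + suc ℓ    ≡⟨ trans (+-comm _ (suc ℓ)) (sym (*-suc (suc ℓ) (length z))) ⟩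
    suc ℓ * suc (length z)      ∎))
    where open ≤-Reasoning

  desubstitute : ∀ {m c} {t v : List B} {z : List A} → Inner (suc ℓ * m + c) t v → Overhang c (h* z) v →
                 ∃ λ t′ → Inner m t′ z × Overhang ℓ t (h* t′)
  desubstitute {m} {c} {t} {z = z} (p , s , refl , m≤p , m≤s) (Q , R , e , Q≤c , R≤c)
    with ++-split p (t ++ s) Q (h* z ++ R) e (≤-trans Q≤c (≤-trans (m≤n+m c _) m≤p))
  ... | p₁ , refl , e₁
    with ++-split-right (p₁ ++ t) s (h* z) R (trans (++-assoc p₁ t s) (sym e₁))
                        (≤-trans R≤c (≤-trans (m≤n+m c _) m≤s))
  ...   | s₁ , refl , e₂ with locate z p₁ t s₁ (trans e₂ (++-assoc p₁ t s₁))
  ...     | located P′ t′ S′ a b refl refl refl t′≡ a≤ℓ b≤ℓ =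
    t′ , (P′ , S′ , refl ,
          preimage-long m c P′ (≤-trans m≤p (length-sandwich Q (h* P′) a Q≤c a≤ℓ)) ,
          preimage-long m c S′ (begin
            suc ℓ * m + c              ≤⟨ m≤s ⟩
            length ((b ++ h* S′) ++ R) ≡⟨ cong length (++-assoc b (h* S′) R) ⟩
            length (b ++ h* S′ ++ R)   ≤⟨ length-sandwich b (h* S′) R b≤ℓ R≤c ⟩
            length (h* S′) + (c + ℓ)   ≡⟨ cong (length (h* S′) +_) (+-comm c ℓ) ⟩
            length (h* S′) + (ℓ + c)   ∎)) ,
    (a , b , t′≡ , a≤ℓ , b≤ℓ)
    where open ≤-Reasoning

-- The Hall–Thue side

_≟ᵀ_ : DecidableEquality Ter
t0 ≟ᵀ t0 = yes refl
t1 ≟ᵀ t1 = yes refl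
t2 ≟ᵀ t2 = yes refl
t0 ≟ᵀ t1 = no λ ()
t0 ≟ᵀ t2 = no λ ()
t1 ≟ᵀ t0 = no λ ()
t1 ≟ᵀ t2 = no λ ()
t2 ≟ᵀ t0 = no λ ()
t2 ≟ᵀ t1 = no λ ()

ternary : List Ter
ternary = t0 ∷ t1 ∷ t2 ∷ []

ternary-complete : ∀ a → a ∈ ternary
ternary-complete t0 = here refl
ternary-complete t1 = there (here refl)
ternary-complete t2 = there (there (here refl))

φ* : List Ter → List Ter
φ* = applyMorph φ

φ-short : ∀ a → length (φ a) ≤ 3
φ-short t0 = ≤-refl
φ-short t1 = s≤s (s≤s z≤n)
φ-short t2 = s≤s z≤n

φ-nonempty : ∀ a → 0 < length (φ a)
φ-nonempty t0 = s≤s z≤n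
φ-nonempty t1 = s≤s z≤n
φ-nonempty t2 = s≤s z≤n

Squarefree : List Ter → Set
Squarefree = EverySquare (λ _ → ⊥)

-- For squarefree words, avoiding 02120 means that 212 occurs only at the ends (see no-interior-212).
record Admissible (y : List Ter) : Set where
  field
    squarefree   : Squarefree y
    avoids-010   : ¬ IsFactor (t0 ∷ t1 ∷ t0 ∷ []) y
    avoids-02120 : ¬ IsFactor (t0 ∷ t2 ∷ t1 ∷ t2 ∷ t0 ∷ []) y

open Admissible

Admissible-factor : ∀ {x y} → Admissible y → IsFactor x y → Admissible x
Admissible-factor A x⊑y = record
  { squarefree   = EverySquare-factor (squarefree A) x⊑y
  ; avoids-010   = λ f → avoids-010 A (IsFactor-trans f x⊑y)
  ; avoids-02120 = λ f → avoids-02120 A (IsFactor-trans f x⊑y)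
  }

Admissible-prefix : ∀ x y → Admissible (x ++ y) → Admissible x
Admissible-prefix x y A = Admissible-factor A ([] , y , refl)

Admissible-tail : ∀ {c y} → Admissible (c ∷ y) → Admissible y
Admissible-tail {c} {y} A = Admissible-factor A (c ∷ [] , [] , cong (c ∷_) (++-identityʳ y))

square-inside : ∀ {y} → Squarefree y → ∀ p u s → 0 < length u → ¬ IsFactor (p ++ (u ++ u) ++ s) y
square-inside sf p u s u>0 f = sf u u>0 (IsFactor-trans (p , s , refl) f)

no-interior-212 : ∀ {y} a b → Admissible y → ¬ IsFactor (a ∷ t2 ∷ t1 ∷ t2 ∷ b ∷ []) y
no-interior-212 t1 b A = square-inside (squarefree A) [] (t1 ∷ t2 ∷ []) (b ∷ []) (s≤s z≤n)
no-interior-212 t2 b A = square-inside (squarefree A) [] (t2 ∷ []) (t1 ∷ t2 ∷ b ∷ []) (s≤s z≤n)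
no-interior-212 t0 t0 A = avoids-02120 A
no-interior-212 t0 t1 A = square-inside (squarefree A) (t0 ∷ []) (t2 ∷ t1 ∷ []) [] (s≤s z≤n)
no-interior-212 t0 t2 A = square-inside (squarefree A) (t0 ∷ t2 ∷ t1 ∷ []) (t2 ∷ []) [] (s≤s z≤n)

φ-preimage-admissible : ∀ {z} → Admissible (φ* z) → Admissible z
φ-preimage-admissible A = record
  { squarefree   = λ { (a ∷ u) _ f → squarefree A (φ* (a ∷ u)) (≤-trans (φ-nonempty a) (length-applyMorph-head φ a u))
                                      (IsFactor-square-applyMorph φ {a ∷ u} f) }
  ; avoids-010   = λ f → square-inside (squarefree A) (t0 ∷ t1 ∷ []) (t2 ∷ t0 ∷ []) (t1 ∷ t2 ∷ []) (s≤s z≤n)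
                           (IsFactor-applyMorph φ f)
  ; avoids-02120 = λ f → square-inside (squarefree A) (t0 ∷ t1 ∷ []) (t2 ∷ t1 ∷ t0 ∷ []) (t1 ∷ t2 ∷ []) (s≤s z≤n)
                           (IsFactor-applyMorph φ f)
  }

-- {1,2} has no squarefree word of length 4.
first-0 : ∀ y → Squarefree y → length y ≤ 3 ⊎ ∃₂ λ q y′ → y ≡ q ++ t0 ∷ y′ × length q ≤ 3
first-0 [] _ = inj₁ z≤n
first-0 (t0 ∷ y) _ = inj₂ ([] , y , refl , z≤n)
first-0 (a ∷ []) _ = inj₁ (s≤s z≤n)
first-0 (a ∷ t0 ∷ y) _ = inj₂ (a ∷ [] , y , refl , s≤s z≤n)
first-0 (a ∷ b ∷ []) _ = inj₁ (s≤s (s≤s z≤n))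
first-0 (a ∷ b ∷ t0 ∷ y) _ = inj₂ (a ∷ b ∷ [] , y , refl , s≤s (s≤s z≤n))
first-0 (a ∷ b ∷ c ∷ []) _ = inj₁ ≤-refl
first-0 (a ∷ b ∷ c ∷ t0 ∷ y) _ = inj₂ (a ∷ b ∷ c ∷ [] , y , refl , ≤-refl)
first-0 (t1 ∷ t1 ∷ y) sf = ⊥-elim (sf (t1 ∷ []) (s≤s z≤n) ([] , y , refl))
first-0 (t2 ∷ t2 ∷ y) sf = ⊥-elim (sf (t2 ∷ []) (s≤s z≤n) ([] , y , refl))
first-0 (a ∷ t1 ∷ t1 ∷ y) sf = ⊥-elim (sf (t1 ∷ []) (s≤s z≤n) (a ∷ [] , y , refl))
first-0 (a ∷ t2 ∷ t2 ∷ y) sf = ⊥-elim (sf (t2 ∷ []) (s≤s z≤n) (a ∷ [] , y , refl))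
first-0 (a ∷ b ∷ t1 ∷ t1 ∷ y) sf = ⊥-elim (sf (t1 ∷ []) (s≤s z≤n) (a ∷ b ∷ [] , y , refl))
first-0 (a ∷ b ∷ t2 ∷ t2 ∷ y) sf = ⊥-elim (sf (t2 ∷ []) (s≤s z≤n) (a ∷ b ∷ [] , y , refl))
first-0 (t1 ∷ t2 ∷ t1 ∷ t2 ∷ y) sf = ⊥-elim (sf (t1 ∷ t2 ∷ []) (s≤s z≤n) ([] , y , refl))
first-0 (t2 ∷ t1 ∷ t2 ∷ t1 ∷ y) sf = ⊥-elim (sf (t2 ∷ t1 ∷ []) (s≤s z≤n) ([] , y , refl))

-- Cutting before every 0 splits an admissible word into the blocks 012, 02, 1 of φ.
mutual
  parse-from-0 : ∀ y → Admissible (t0 ∷ y) → ∃₂ λ z r → t0 ∷ y ≡ φ* z ++ r × length r ≤ 2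
  parse-from-0 [] _ = [] , t0 ∷ [] , refl , s≤s z≤n
  parse-from-0 (t0 ∷ y) A = ⊥-elim (squarefree A (t0 ∷ []) (s≤s z≤n) ([] , y , refl))
  parse-from-0 (t1 ∷ []) _ = [] , t0 ∷ t1 ∷ [] , refl , ≤-refl
  parse-from-0 (t1 ∷ t0 ∷ y) A = ⊥-elim (avoids-010 A ([] , y , refl))
  parse-from-0 (t1 ∷ t1 ∷ y) A = ⊥-elim (squarefree A (t1 ∷ []) (s≤s z≤n) (t0 ∷ [] , y , refl))
  parse-from-0 (t1 ∷ t2 ∷ y) A with parse-after-2 t1 y (Admissible-tail A)
  ... | z , r , refl , r≤2 = t0 ∷ z , r , refl , r≤2
  parse-from-0 (t2 ∷ y) A with parse-after-2 t0 y A
  ... | z , r , refl , r≤2 = t1 ∷ z , r , refl , r≤2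

  parse-after-2 : ∀ a y → Admissible (a ∷ t2 ∷ y) → ∃₂ λ z r → y ≡ φ* z ++ r × length r ≤ 2
  parse-after-2 a [] _ = [] , [] , refl , z≤n
  parse-after-2 a (t0 ∷ y) A = parse-from-0 y (Admissible-tail (Admissible-tail A))
  parse-after-2 a (t1 ∷ []) _ = t2 ∷ [] , [] , refl , z≤n
  parse-after-2 a (t1 ∷ t0 ∷ y) A with parse-from-0 y (Admissible-tail (Admissible-tail (Admissible-tail A)))
  ... | z , r , e , r≤2 = t2 ∷ z , r , cong (t1 ∷_) e , r≤2
  parse-after-2 a (t1 ∷ t1 ∷ y) A = ⊥-elim (squarefree A (t1 ∷ []) (s≤s z≤n) (a ∷ t2 ∷ [] , y , refl))
  parse-after-2 a (t1 ∷ t2 ∷ []) _ = t2 ∷ [] , t2 ∷ [] , refl , s≤s z≤n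
  parse-after-2 a (t1 ∷ t2 ∷ b ∷ y) A = ⊥-elim (no-interior-212 a b A ([] , y , refl))
  parse-after-2 a (t2 ∷ y) A = ⊥-elim (squarefree A (t2 ∷ []) (s≤s z≤n) (a ∷ [] , y , refl))

φ-parse : ∀ {y} → Admissible y → ∃ λ z → Admissible z × Overhang 3 (φ* z) y
φ-parse {y} A with first-0 y (squarefree A)
... | inj₁ y≤3 = [] , Admissible-factor A ([] , y , refl) , y , [] , sym (++-identityʳ y) , y≤3 , z≤n
... | inj₂ (q , y′ , refl , q≤3) with parse-from-0 y′ (Admissible-factor A (q , [] , cong (q ++_) (++-identityʳ _)))
...   | z , r , e , r≤2 =
  z , φ-preimage-admissible (Admissible-factor A ov⇒⊑) , ov
  where
  ov : Overhang 3 (φ* z) (q ++ t0 ∷ y′)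
  ov = q , r , cong (q ++_) e , q≤3 , ≤-trans r≤2 (n≤1+n 2)
  ov⇒⊑ : IsFactor (φ* z) (q ++ t0 ∷ y′)
  ov⇒⊑ = Overhang⇒IsFactor ov

φ² : Ter → List Ter
φ² a = φ* (φ a)

φ²-short : ∀ a → length (φ² a) ≤ suc 5
φ²-short t0 = ≤-refl
φ²-short t1 = s≤s (s≤s (s≤s (s≤s z≤n)))
φ²-short t2 = s≤s (s≤s z≤n)

φ²-long : ∀ a → 2 ≤ length (φ² a)
φ²-long t0 = s≤s (s≤s z≤n)
φ²-long t1 = s≤s (s≤s z≤n)
φ²-long t2 = ≤-refl

φ²-parse : ∀ {y} → Admissible y → ∃ λ z → Admissible z × Overhang 12 (applyMorph φ² z) y
φ²-parse A with φ-parse A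
... | z₁ , A₁ , ov₁ with φ-parse A₁
...   | z , A , ov = z , A , subst (λ w → Overhang 12 w _) (applyMorph-∘ φ φ z) (Overhang-∘ φ-short ov₁ ov)

module TernaryTests = ReversedTests _≟ᵀ_

admissible? : List Ter → Bool
admissible? rw =
  TernaryTests.squareSuffixesOK? (λ _ → false) 7 rw ∧
  not (TernaryTests.endsWith? (t0 ∷ t1 ∷ t0 ∷ []) rw) ∧
  not (TernaryTests.endsWith? (t0 ∷ t2 ∷ t1 ∷ t2 ∷ t0 ∷ []) rw)

admissible?-sound : ∀ c rw → Admissible (reverse (c ∷ rw)) → T (admissible? (c ∷ rw))
admissible?-sound c rw A = Equivalence.from T-∧
  ( TernaryTests.squareSuffixesOK?-sound (λ _ → false) (λ _ ()) 7 c rw (squarefree A)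
  , Equivalence.from T-∧
      ( TernaryTests.avoids⇒¬endsWith? _ (c ∷ rw) (avoids-010 A)
      , TernaryTests.avoids⇒¬endsWith? _ (c ∷ rw) (avoids-02120 A)))

open Exploration ternary ternary-complete Admissible Admissible-prefix admissible? admissible?-sound
  using () renaming (explore-sound to exploreᵀ-sound)

middle-in-φ⁶? : ℕ → List Ter → Bool
middle-in-φ⁶? k rw = TernaryTests.isFactor? (take k (drop 4 (reverse rw))) (φIter 6)

-- Finite check: every admissible word of length k + 8 has its middle factor of length k in φ⁶(0).
-- (Stated with ≡ true: checking T (explore …) by _ is several times slower.)
short-middles-in-φ⁶ : ∀ k → k ≤ 10 →
                      explore ternary admissible? (λ _ → false) (middle-in-φ⁶? k) (4 + (k + 4)) [] ≡ true
short-middles-in-φ⁶ 0 _ = refl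
short-middles-in-φ⁶ 1 _ = refl
short-middles-in-φ⁶ 2 _ = refl
short-middles-in-φ⁶ 3 _ = refl
short-middles-in-φ⁶ 4 _ = refl
short-middles-in-φ⁶ 5 _ = refl
short-middles-in-φ⁶ 6 _ = refl
short-middles-in-φ⁶ 7 _ = refl
short-middles-in-φ⁶ 8 _ = refl
short-middles-in-φ⁶ 9 _ = refl
short-middles-in-φ⁶ 10 _ = refl
short-middles-in-φ⁶ (suc (suc (suc (suc (suc (suc (suc (suc (suc (suc (suc _)))))))))))
  (s≤s (s≤s (s≤s (s≤s (s≤s (s≤s (s≤s (s≤s (s≤s (s≤s ()))))))))))

short-inner-factor : ∀ {t y} → length t ≤ 10 → Admissible y → Inner 4 t y → IsFactor t (φIter 6)
short-inner-factor {t} t≤10 A I with Inner-exact I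
... | b , s , x⊑y , |b|≡4 , |s|≡4
  with exploreᵀ-sound {λ _ → false} {middle-in-φ⁶? (length t)} (4 + (length t + 4)) [] (b ++ t ++ s) |x|≡
                      (Equivalence.from T-≡ (short-middles-in-φ⁶ (length t) t≤10)) (Admissible-factor A x⊑y)
  where
  |x|≡ : length (b ++ t ++ s) ≡ 4 + (length t + 4)
  |x|≡ = trans (length-++³ b t s) (cong₂ _+_ |b|≡4 (cong (length t +_) |s|≡4))
... | inj₁ (_ , _ , _ , ())
... | inj₂ found =
  TernaryTests.isFactor?-sound t (φIter 6) (subst (λ w → T (TernaryTests.isFactor? w (φIter 6))) middle≡t found)
  where
  middle≡t : take (length t) (drop 4 (reverse (reverse (b ++ t ++ s)))) ≡ t
  middle≡t = begin
    take (length t) (drop 4 (reverse (reverse (b ++ t ++ s))))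
      ≡⟨ cong (λ w → take (length t) (drop 4 w)) (reverse-involutive (b ++ t ++ s)) ⟩
    take (length t) (drop 4 (b ++ t ++ s))
      ≡⟨ cong (λ n → take (length t) (drop n (b ++ t ++ s))) |b|≡4 ⟨
    take (length t) (drop (length b) (b ++ t ++ s))            ≡⟨ cong (take (length t)) (drop-length-++ b (t ++ s)) ⟩
    take (length t) (t ++ s)                                   ≡⟨ take-length-++ t s ⟩
    t                                                          ∎
    where open ≡-Reasoning

open Desubstitution φ² 5 φ²-short using () renaming (desubstitute to φ²-desubstitute)

margin : ℕ → ℕ
margin zero = 4
margin (suc n) = 6 * margin n + 12

4≤margin : ∀ n → 4 ≤ margin n
4≤margin zero = ≤-refl
4≤margin (suc n) = ≤-trans (≤-trans (4≤margin n) (m≤n*m (margin n) 6)) (m≤m+n _ 12)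

φ²-preimage-shorter : ∀ {t t′} → 10 < length t → Overhang 5 t (applyMorph φ² t′) → length t′ < length t
φ²-preimage-shorter {t} {t′} t>10 ov = *-cancelˡ-< 2 (length t′) (length t) (begin-strict
  2 * length t′              ≤⟨ length-applyMorph-≥ φ²-long t′ ⟩
  length (applyMorph φ² t′)  ≤⟨ Overhang-length ov ⟩
  length t + 10              <⟨ +-monoʳ-< (length t) t>10 ⟩
  length t + length t        ≡⟨ cong (length t +_) (+-identityʳ (length t)) ⟨
  2 * length t               ∎)
  where open ≤-Reasoning

inner-factor : ∀ n {t y} → length t ≤ n → Admissible y → Inner (margin n) t y → ∃ λ k → IsFactor t (φIter k)
inner-factor n {t} t≤n A I with length t ≤? 10
... | yes t≤10 = 6 , short-inner-factor t≤10 A (Inner-weaken (4≤margin n) I)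
inner-factor zero t≤0 A I | no t≰10 = ⊥-elim (t≰10 (≤-trans t≤0 z≤n))
inner-factor (suc n) {t} t≤n A I | no t≰10 with φ²-parse A
... | z , Az , ov with φ²-desubstitute I ov
...   | t′ , I′ , ov′ with inner-factor n (≤-pred (≤-trans (φ²-preimage-shorter {t′ = t′} (≰⇒> t≰10) ov′) t≤n)) Az I′
...     | k , t′⊑ = suc (suc k) , IsFactor-trans (Overhang⇒IsFactor ov′)
                      (subst (IsFactor _) (sym (applyMorph-∘ φ φ (φIter k))) (IsFactor-applyMorph φ² t′⊑))

φIter-bound : ℕ → ℕ
φIter-bound zero = 4
φIter-bound (suc k) = 3 * φIter-bound k + 6

φIter-in-long : ∀ k {y} → Admissible y → φIter-bound k ≤ length y → IsFactor (φIter k) y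
φIter-in-long zero {y} A y≥4 with first-0 y (squarefree A)
... | inj₁ y≤3 = ⊥-elim (≤⇒≯ y≤3 y≥4)
... | inj₂ (q , y′ , refl , _) = q , y′ , refl
φIter-in-long (suc k) {y} A long with φ-parse A
... | z , Az , ov = IsFactor-trans (IsFactor-applyMorph φ (φIter-in-long k Az z-long)) (Overhang⇒IsFactor ov)
  where
  z-long : φIter-bound k ≤ length z
  z-long = *-cancelˡ-≤ 3 (+-cancelʳ-≤ 6 _ _ (begin
    3 * φIter-bound k + 6       ≤⟨ long ⟩
    length y                    ≤⟨ Overhang-length ov ⟩
    length (φ* z) + 6           ≤⟨ +-monoˡ-≤ 6 (length-applyMorph-≤ φ-short z) ⟩
    3 * length z + 6            ∎))
    where open ≤-Reasoning

-- The binary side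

_≟ᴮ_ : DecidableEquality Bin
b0 ≟ᴮ b0 = yes refl
b1 ≟ᴮ b1 = yes refl
b0 ≟ᴮ b1 = no λ ()
b1 ≟ᴮ b0 = no λ ()

binary : List Bin
binary = b0 ∷ b1 ∷ []

binary-complete : ∀ c → c ∈ binary
binary-complete b0 = here refl
binary-complete b1 = there (here refl)

g5* : List Ter → List Bin
g5* = applyMorph g5

g5-short : ∀ a → length (g5 a) ≤ suc 24
g5-short t0 = ≤-refl
g5-short t1 = m≤m+n 18 7
g5-short t2 = m≤m+n 7 18

g5-long : ∀ a → 7 ≤ length (g5 a)
g5-long t0 = m≤m+n 7 18
g5-long t1 = m≤m+n 7 11
g5-long t2 = ≤-refl

SquaresAllowed : List Bin → Set
SquaresAllowed = EverySquare (λ u → u ++ u ∈ allowedSquares)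

SquaresAllowed-prefix : ∀ x y → SquaresAllowed (x ++ y) → SquaresAllowed x
SquaresAllowed-prefix x y sq = EverySquare-factor sq ([] , y , refl)

allowedSquares-short : All (λ x → length x ≤ 10) allowedSquares
allowedSquares-short = from-yes (All.all? (λ x → length x ≤? 10) allowedSquares)

no-long-square : ∀ {v} u → SquaresAllowed v → 6 ≤ length u → ¬ IsFactor (u ++ u) v
no-long-square u sq u≥6 uu⊑v =
  ≤⇒≯ (All.lookup allowedSquares-short (sq u (≤-trans (s≤s z≤n) u≥6) uu⊑v)) (begin-strict
  10                   <⟨ m≤m+n 11 1 ⟩
  6 + 6                ≤⟨ +-mono-≤ u≥6 u≥6 ⟩
  length u + length u  ≡⟨ length-++ u ⟨
  length (u ++ u)      ∎)
  where open ≤-Reasoning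

g5-preimage-admissible : ∀ {y} → SquaresAllowed (g5* y) → Admissible y
g5-preimage-admissible {y} sq = record
  { squarefree   = λ { (a ∷ u) _ f →
                       no-long-square (g5* (a ∷ u)) sq
                         (≤-trans (≤-trans (n≤1+n 6) (g5-long a)) (length-applyMorph-head g5 a u))
                         (IsFactor-square-applyMorph g5 {a ∷ u} f) }
  ; avoids-010   = square-at (t0 ∷ t1 ∷ t0 ∷ []) 13 18 (m≤m+n 6 12) refl
  ; avoids-02120 = square-at (t0 ∷ t2 ∷ t1 ∷ t2 ∷ t0 ∷ []) 13 25 (m≤m+n 6 19) refl
  }
  where
  square-at : ∀ w i n → let x = g5* w ; u = take n (drop i x) in
              6 ≤ length u → take i x ++ (u ++ u) ++ drop (i + n + n) x ≡ x → ¬ IsFactor w y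
  square-at w i n u≥6 e f = no-long-square (take n (drop i (g5* w))) sq u≥6
    (IsFactor-trans (take i (g5* w) , drop (i + n + n) (g5* w) , e) (IsFactor-applyMorph g5 f))

module BinaryTests = ReversedTests _≟ᴮ_

allowedSquare? : List Bin → Bool
allowedSquare? u = any (BinaryTests._==_ (u ++ u)) allowedSquares

allowedSquare?-complete : ∀ u → u ++ u ∈ allowedSquares → T (allowedSquare? u)
allowedSquare?-complete u uu∈ =
  any⁺ (BinaryTests._==_ (u ++ u)) (Any.map (λ { refl → BinaryTests.==-refl (u ++ u) }) uu∈)

squaresAllowed? : List Bin → Bool
squaresAllowed? = BinaryTests.squareSuffixesOK? allowedSquare? 13

squaresAllowed?-sound : ∀ c rw → SquaresAllowed (reverse (c ∷ rw)) → T (squaresAllowed? (c ∷ rw))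
squaresAllowed?-sound = BinaryTests.squareSuffixesOK?-sound allowedSquare? allowedSquare?-complete 13

open Exploration binary binary-complete SquaresAllowed SquaresAllowed-prefix squaresAllowed? squaresAllowed?-sound
  using () renaming (explore-prefix to exploreᴮ-prefix)

-- context a is the 18-letter suffix shared by the images of all admissible words ending in a
-- (a 2 is always preceded by 0 or 1); these suffixes determine where the images of letters are cut.
context : Ter → List Bin
context t0 = b0 ∷ b0 ∷ b0 ∷ b1 ∷ b1 ∷ b1 ∷ b0 ∷ b0 ∷ b0 ∷ b0 ∷ b1 ∷ b1 ∷ b0 ∷ b0 ∷ b0 ∷ b1 ∷ b1 ∷ b1 ∷ []
context t1 = b0 ∷ b0 ∷ b0 ∷ b0 ∷ b1 ∷ b0 ∷ b0 ∷ b0 ∷ b0 ∷ b0 ∷ b1 ∷ b1 ∷ b0 ∷ b0 ∷ b0 ∷ b1 ∷ b1 ∷ b1 ∷ []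
context t2 = b0 ∷ b0 ∷ b0 ∷ b1 ∷ b1 ∷ b0 ∷ b0 ∷ b0 ∷ b1 ∷ b1 ∷ b1 ∷ b0 ∷ b0 ∷ b0 ∷ b0 ∷ b0 ∷ b1 ∷ b1 ∷ []

context-after-image : ∀ a b → SquaresAllowed (context a ++ g5 b) → ∃ λ d → context a ++ g5 b ≡ d ++ context b
context-after-image t2 t2 sq = ⊥-elim (no-long-square (g5 t2) sq (n≤1+n 6) (take 11 (context t2) , [] , refl))
context-after-image t0 t0 _ = take 25 (context t0 ++ g5 t0) , refl
context-after-image t0 t1 _ = take 18 (context t0 ++ g5 t1) , refl
context-after-image t0 t2 _ = take 7 (context t0 ++ g5 t2) , refl
context-after-image t1 t0 _ = take 25 (context t1 ++ g5 t0) , refl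
context-after-image t1 t1 _ = take 18 (context t1 ++ g5 t1) , refl
context-after-image t1 t2 _ = take 7 (context t1 ++ g5 t2) , refl
context-after-image t2 t0 _ = take 25 (context t2 ++ g5 t0) , refl
context-after-image t2 t1 _ = take 18 (context t2 ++ g5 t1) , refl

endsWithContext? : List Bin → Bool
endsWithContext? rw = any (λ a → BinaryTests.endsWith? (context a) rw) ternary

-- Finite check: every word of length 54 with only allowed squares has a prefix ending with a context.
context-exploration : explore binary squaresAllowed? endsWithContext? endsWithContext? 54 [] ≡ true
context-exploration = refl

imageAfter? : Ter → List Bin → Bool
imageAfter? a rw = any (λ b → BinaryTests._==_ rw (reverse (context a ++ g5 b))) ternary

-- Finite check: after a context, every word of length 26 with only allowed squares starts with an image.
image-exploration : ∀ a →
                    explore binary squaresAllowed? (imageAfter? a) (imageAfter? a) 26 (reverse (context a)) ≡ true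
image-exploration t0 = refl
image-exploration t1 = refl
image-exploration t2 = refl

-- Opaque, so that unification never unfolds the explorations behind these lemmas.
opaque
  context-within-54 : ∀ v → SquaresAllowed v → 54 ≤ length v →
                      ∃₂ λ q a → ∃ λ x → v ≡ q ++ context a ++ x × length (q ++ context a) ≤ 54
  context-within-54 v sq v≥54 =
    let x₁ , x₂ , v≡ , x₁≤54 , found = exploreᴮ-prefix {endsWithContext?} 54 [] v v≥54 context-exploration sq
        a , ends = satisfied (any⁻ (λ a → BinaryTests.endsWith? (context a) (reverse x₁)) ternary found)
        q , e = BinaryTests.endsWith?-sound (context a) (reverse x₁) ends
        x₁≡ : x₁ ≡ q ++ context a
        x₁≡ = trans (sym (reverse-involutive x₁)) e
    in q , a , x₂ , trans v≡ (trans (cong (_++ x₂) x₁≡) (++-assoc q (context a) x₂)) ,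
       subst (λ w → length w ≤ 54) x₁≡ x₁≤54

  image-after-context : ∀ a x → SquaresAllowed (context a ++ x) → 26 ≤ length x → ∃₂ λ b x′ → x ≡ g5 b ++ x′
  image-after-context a x sq x≥26 =
    let x₁ , x₂ , x≡ , _ , found = exploreᴮ-prefix {imageAfter? a} 26 (reverse (context a)) x x≥26 (image-exploration a)
                                     (subst SquaresAllowed (sym (ʳ++-of-reverse (context a) x)) sq)
        b , equal = satisfied (any⁻ (λ b → BinaryTests._==_ (x₁ ʳ++ reverse (context a)) (reverse (context a ++ g5 b)))
                                    ternary found)
        x₁≡ : context a ++ x₁ ≡ context a ++ g5 b
        x₁≡ = begin
          context a ++ x₁                        ≡⟨ cong (_++ x₁) (reverse-involutive (context a)) ⟨
          reverse (reverse (context a)) ++ x₁    ≡⟨ reverse-ʳ++ x₁ (reverse (context a)) ⟨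
          reverse (x₁ ʳ++ reverse (context a))
            ≡⟨ cong reverse (BinaryTests.==-sound (x₁ ʳ++ reverse (context a)) (reverse (context a ++ g5 b)) equal) ⟩
          reverse (reverse (context a ++ g5 b))  ≡⟨ reverse-involutive (context a ++ g5 b) ⟩
          context a ++ g5 b                      ∎
    in b , x₂ , trans x≡ (cong (_++ x₂) (++-cancelˡ (context a) x₁ (g5 b) x₁≡))
    where open ≡-Reasoning

g5-parse-after-context : ∀ n a x → length x ≤ n → SquaresAllowed (context a ++ x) →
                         ∃₂ λ y r → x ≡ g5* y ++ r × length r ≤ 25
g5-parse-after-context n a x x≤n sq with 26 ≤? length x
... | no x≱26 = [] , x , refl , ≤-pred (≰⇒> x≱26)
g5-parse-after-context zero a x x≤0 sq | yes x≥26 = ⊥-elim (≤⇒≯ x≤0 (≤-trans (s≤s z≤n) x≥26))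
g5-parse-after-context (suc n) a x x≤n sq | yes x≥26 with image-after-context a x sq x≥26
... | b , x′ , refl with context-after-image a b (SquaresAllowed-prefix (context a ++ g5 b) x′
                           (subst SquaresAllowed (sym (++-assoc (context a) (g5 b) x′)) sq))
...   | d , e with g5-parse-after-context n b x′ x′≤n (EverySquare-factor sq (d , [] , shifted))
  where
  x′≤n : length x′ ≤ n
  x′≤n = ≤-pred (≤-trans (+-monoˡ-≤ (length x′) (≤-trans (s≤s z≤n) (g5-long b)))
                         (≤-trans (≤-reflexive (sym (length-++ (g5 b)))) x≤n))
  shifted : d ++ (context b ++ x′) ++ [] ≡ context a ++ g5 b ++ x′
  shifted = begin
    d ++ (context b ++ x′) ++ []  ≡⟨ cong (d ++_) (++-identityʳ _) ⟩
    d ++ context b ++ x′         ≡⟨ ++-assoc d (context b) x′ ⟨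
    (d ++ context b) ++ x′       ≡⟨ cong (_++ x′) e ⟨
    (context a ++ g5 b) ++ x′    ≡⟨ ++-assoc (context a) (g5 b) x′ ⟩
    context a ++ g5 b ++ x′      ∎
    where open ≡-Reasoning
...     | y , r , refl , r≤25 = b ∷ y , r , sym (++-assoc (g5 b) (g5* y) r) , r≤25

g5-parse : ∀ {v} → SquaresAllowed v → ∃ λ y → Overhang 54 (g5* y) v
g5-parse {v} sq with 54 ≤? length v
... | no v≱54 = [] , v , [] , sym (++-identityʳ v) , <⇒≤ (≰⇒> v≱54) , z≤n
... | yes v≥54 with context-within-54 v sq v≥54
...   | q , a , x , refl , qc≤54
  with g5-parse-after-context (length x) a x ≤-refl (EverySquare-factor sq (q , [] , cong (q ++_) (++-identityʳ _)))
...     | y , r , refl , r≤25 = y , q ++ context a , r , sym (++-assoc q (context a) _) , qc≤54 , ≤-trans r≤25 (m≤m+n 25 29)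

open Desubstitution g5 24 g5-short using () renaming (desubstitute to g5-desubstitute)

g5-preimage-short : ∀ {t u} → Overhang 24 u (g5* t) → length t ≤ length u + 48
g5-preimage-short {t} ov = begin
  length t             ≤⟨ m≤n*m (length t) 7 ⟩
  7 * length t         ≤⟨ length-applyMorph-≥ g5-long t ⟩
  length (g5* t)       ≤⟨ Overhang-length ov ⟩
  _ + 48               ∎
  where open ≤-Reasoning

inner-factor-of-g5b3 : ∀ {u} v → SquaresAllowed v → Inner (25 * margin (length u + 48) + 54) u v → FactorOfG5b3 u
inner-factor-of-g5b3 {u} v sq I with g5-parse {v} sq
... | y , ov with g5-desubstitute I ov
...   | t , It , ovt with inner-factor (length u + 48) (g5-preimage-short {t} {u} ovt)
                            (g5-preimage-admissible {y} (EverySquare-factor sq (Overhang⇒IsFactor ov))) It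
...     | k , t⊑ = k , IsFactor-trans (Overhang⇒IsFactor ovt) (IsFactor-applyMorph g5 t⊑)

φIter-image-in-long : ∀ k {v} → SquaresAllowed v → 25 * φIter-bound k + 108 ≤ length v → IsFactor (g5* (φIter k)) v
φIter-image-in-long k {v} sq long with g5-parse {v} sq
... | y , ov = IsFactor-trans (IsFactor-applyMorph g5 (φIter-in-long k Ay y-long)) (Overhang⇒IsFactor ov)
  where
  Ay = g5-preimage-admissible {y} (EverySquare-factor sq (Overhang⇒IsFactor ov))
  y-long : φIter-bound k ≤ length y
  y-long = *-cancelˡ-≤ 25 (+-cancelʳ-≤ 108 _ _ (begin
    25 * φIter-bound k + 108  ≤⟨ long ⟩
    length v                  ≤⟨ Overhang-length ov ⟩
    length (g5* y) + 108      ≤⟨ +-monoˡ-≤ 108 (length-applyMorph-≤ g5-short y) ⟩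
    25 * length y + 108       ∎))
    where open ≤-Reasoning

-- Bi-infinite words

slice-+ : ∀ (w : BiWord) i m n → slice w i (m + n) ≡ slice w i m ++ slice w (i +ℤ toℤ m) n
slice-+ w i zero n = cong (λ j → slice w j n) (sym (+ℤ-identityʳ i))
slice-+ w i (suc m) n = cong (w i ∷_) (trans (slice-+ w (i +ℤ toℤ 1) m n)
                          (cong (λ j → slice w (i +ℤ toℤ 1) m ++ slice w j n) (+ℤ-assoc i (toℤ 1) (toℤ m))))

length-slice : ∀ (w : BiWord) i n → length (slice w i n) ≡ n
length-slice w i zero = refl
length-slice w i (suc n) = cong suc (length-slice w (i +ℤ toℤ 1) n)

IsFactor-slice : ∀ (w : BiWord) i n {u} → IsFactor u (slice w i n) → FactorOfBi w u
IsFactor-slice w i n {u} (p , s , e) =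
  j , sym (proj₁ (++-split-length u s _ _ u++s≡ (sym (length-slice w j (length u)))))
  where
  j = i +ℤ toℤ (length p)
  n≡ : n ≡ length p + (length u + length s)
  n≡ = trans (sym (length-slice w i n)) (trans (cong length (sym e)) (length-++³ p u s))
  u++s≡ : u ++ s ≡ slice w j (length u) ++ slice w (j +ℤ toℤ (length u)) (length s)
  u++s≡ = trans (proj₂ (++-split-length p (u ++ s) _ _ (trans e (trans (cong (slice w i) n≡) (slice-+ w i (length p) _)))
                          (sym (length-slice w i (length p)))))
                (slice-+ w j (length u) (length s))

slice-squaresAllowed : ∀ {w} → OnlyAllowedSquares w → ∀ i n → SquaresAllowed (slice w i n)
slice-squaresAllowed oas i n u u>0 uu⊑ = oas u u>0 (IsFactor-slice _ i n uu⊑)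

slice-around : ∀ (w : BiWord) i m {u} → slice w i (length u) ≡ u → Inner m u (slice w (i - toℤ m) (m + (length u + m)))
slice-around w i m {u} e = slice w (i - toℤ m) m , slice w (i +ℤ toℤ (length u)) m ,
  trans (slice-+ w (i - toℤ m) m _) (cong (slice w (i - toℤ m) m ++_)
    (trans (cong (λ j → slice w j (length u + m)) back-to-i)
           (trans (slice-+ w i (length u) m) (cong (_++ slice w (i +ℤ toℤ (length u)) m) e)))) ,
  ≤-reflexive (sym (length-slice w _ m)) , ≤-reflexive (sym (length-slice w _ m))
  where
  back-to-i : (i - toℤ m) +ℤ toℤ m ≡ i
  back-to-i = trans (+ℤ-assoc i (- toℤ m) (toℤ m)) (trans (cong (i +ℤ_) (+ℤ-inverseˡ (toℤ m))) (+ℤ-identityʳ i))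

theorem4 : (w : BiWord) → OnlyAllowedSquares w →
  (u : List Bin) → FactorOfBi w u ⇔ FactorOfG5b3 u
theorem4 w oas u = mk⇔ forward backward
  where
  forward : FactorOfBi w u → FactorOfG5b3 u
  forward (i , e) =
    inner-factor-of-g5b3 _ (slice-squaresAllowed oas (i - toℤ m) (m + (length u + m))) (slice-around w i m e)
    where m = 25 * margin (length u + 48) + 54
  backward : FactorOfG5b3 u → FactorOfBi w u
  backward (k , u⊑) = IsFactor-slice w (toℤ 0) n (IsFactor-trans u⊑
    (φIter-image-in-long k (slice-squaresAllowed oas (toℤ 0) n) (≤-reflexive (sym (length-slice w (toℤ 0) n)))))
    where n = 25 * φIter-bound k + 108
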